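{- Let $n\ge 2$ be an integer and let $(W_r)_{r\in\mathbb{Z}}$ be any generalized $n$-step Fibonacci sequence. Then for every nonnegative integer $k$ and every integer $r$, each of the following holds: \[ \sum_{j=0}^{k}\sum_{s=0}^{j}(-1)^{j+s}\binom kj\binom js4^jW_{r-(2n+2)k+2nj+s}=W_r, \] \[ \sum_{j=0}^{k}\sum_{s=0}^{j}(-4)^{k-j}\binom kj\binom js4^sW_{r-2k-2nj+(2n+1)s}=W_r, \] \[ \sum_{j=0}^{k}\sum_{s=0}^{j}(-1)^s\binom kj\binom js4^{k-j+s}W_{r-k-(2n+1)j+2ns}=W_r, \] \[ \sum_{j=0}^{k}\sum_{s=0}^{j}(-1)^{j-k}\binom kj\binom js4^{j-k-s}W_{r-(2n+1)k+2nj+2s}=W_r, \] \[ \sum_{j=0}^{k}\sum_{s=0}^{j}(-1)^s\binom kj\binom js4^{j-k-s}W_{r-2nk+(2n+1)j+s}=W_r, \] and \[ \sum_{j=0}^{k}\sum_{s=0}^{j}(-1)^{j+s}\binom kj\binom js4^{k-s}W_{r+2nk+j+s}=W_r. \]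
   Context: A generalized $n$-step Fibonacci sequence is any sequence $(W_r)_{r\in\mathbb{Z}}$ of complex numbers satisfying $W_r=\sum_{i=1}^{n}W_{r-i}$ for all $r\in\mathbb{Z}$. -}

module Defs where

open import Level using (Level)
open import Data.Nat as ℕ using (ℕ; zero; suc)
open import Data.Integer as ℤ using (ℤ; +_; -[1+_])
open import Algebra.Bundles using (CommutativeRing; Semiring)
open import Data.Nat.Combinatorics using (_C_)
import Algebra.Definitions.RawSemiring as RS

-- Generic definitions over a commutative ring R (the paper works over ℂ,
-- which is one instance).
module RingDefs {c ℓ : Level} (R : CommutativeRing c ℓ) where
  open CommutativeRing R public
    using (Carrier; _≈_; 0#; 1#; semiring)
    renaming (_+_ to _+ᴿ_; _*_ to _*ᴿ_; -_ to -ᴿ_)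
  open RS (Semiring.rawSemiring semiring) using (_×_; _^_)

  sumRange : ℕ → (ℕ → Carrier) → Carrier
  sumRange zero    f = 0#
  sumRange (suc n) f = sumRange n f +ᴿ f n

  sumTo : ℕ → (ℕ → Carrier) → Carrier
  sumTo k f = sumRange (suc k) f

  IsGenFib : ℕ → (ℤ → Carrier) → Set ℓ
  IsGenFib n W = ∀ (r : ℤ) → W r ≈ sumRange n (λ i → W (r ℤ.- + suc i))

  -- integer power x^z, given an element y that serves as x⁻¹
  zpow : Carrier → Carrier → ℤ → Carrier
  zpow x y (+ m)      = x ^ m
  zpow x y -[1+ m ]   = y ^ suc m

  four : Carrier
  four = 4 × 1#

  -- (-1)^z   (note (-1)⁻¹ = -1)
  sgn : ℤ → Carrier
  sgn z = zpow (-ᴿ 1#) (-ᴿ 1#) z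

  -- (-4)^z for integer exponent, given inv4 = 4⁻¹  (so (-4)⁻¹ = - inv4)
  powNeg4 : Carrier → ℤ → Carrier
  powNeg4 inv4 z = zpow (-ᴿ four) (-ᴿ inv4) z

  pow4 : Carrier → ℤ → Carrier
  pow4 inv4 z = zpow four inv4 z

  binom : ℕ → ℕ → Carrier → Carrier
  binom k j x = (k C j) × x

{-# OPTIONS --safe #-}
module Submission where

-- Subtracting the recurrence at t and t + 1 gives W(t + 1) + W(t − n) = 2 W(t). Used at t + n, t + 2n
-- and t + 2n + 1 it yields the four-term relation W(t) + 4 W(t + 2n + 1) = 4 W(t + 2n) + W(t + 2n + 2).
-- Solving that relation for each of its four terms (dividing by 4 when the middle terms are isolated)
-- writes W(t) as α W(t + P) + β W(t + Q) + γ W(t + S). Iterating such a three-term recurrence k times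
-- and collecting terms gives W(r) = Σ_{a+b+s=k} k!/(a! b! s!) α^a β^b γ^s W(r + aP + bQ + sS), and with
-- a = k − j, b = j − s the multinomial coefficient becomes C(k, j) C(j, s). The six identities are the
-- six resulting choices of (α, P), (β, Q), (γ, S).

open import Defs
open import Level using (Level)
open import Data.Nat as ℕ using (ℕ; zero; suc; _≤_; _<_; _∸_; s≤s)
import Data.Nat.Properties as ℕₚ
open import Data.Nat.Combinatorics using (_C_; nCk+nC[k+1]≡[n+1]C[k+1]; k>n⇒nCk≡0)
open import Data.Integer using (ℤ; +_; _+_; _-_; _*_; -_)
import Data.Integer.Properties as ℤₚ
open import Data.Integer.Tactic.RingSolver using (solve-∀)
open import Data.Product using (_×_; _,_)
open import Function using (_∘_)
open import Relation.Binary.PropositionalEquality as ≡ using (_≡_)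
open import Algebra.Bundles using (CommutativeRing; Semiring)

module _ {c ℓ : Level} (R : CommutativeRing c ℓ) where
  open RingDefs R
  open CommutativeRing R
    using ( setoid; refl; sym; trans; reflexive; +-cong; +-congˡ; +-congʳ; *-cong; *-congˡ; *-congʳ
          ; +-assoc; +-comm; *-assoc; *-comm; +-identityˡ; +-identityʳ; *-identityˡ; *-identityʳ
          ; distribˡ; distribʳ; zeroˡ; -‿inverseˡ; +-monoid; +-commutativeMonoid; +-commutativeSemigroup
          ; *-commutativeSemigroup; commutativeSemiring; ring )
  open import Relation.Binary.Reasoning.Setoid setoid
  open import Algebra.Definitions.RawSemiring (Semiring.rawSemiring semiring) using (_^_) renaming (_×_ to _×ᴿ_)
  open import Algebra.Properties.Monoid.Mult +-monoid using (×-congˡ; ×-congʳ; ×-homo-1; ×-homo-+)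
  open import Algebra.Properties.CommutativeMonoid.Mult +-commutativeMonoid using (×-distrib-+)
  open import Algebra.Properties.Semiring.Mult semiring using (×-comm-*; ×-assoc-*)
  open import Algebra.Properties.CommutativeSemigroup +-commutativeSemigroup
    using (interchange; xy∙z≈xz∙y; xy∙z≈yx∙z; xy∙z≈zx∙y)
  open import Algebra.Properties.CommutativeSemigroup *-commutativeSemigroup
    using () renaming (x∙yz≈y∙xz to x*yz≈y*xz; x∙yz≈xz∙y to x*yz≈xz*y)
  open import Algebra.Properties.Semiring.Exp semiring using (^-congˡ; ^-congʳ; ^-homo-*)
  open import Algebra.Properties.CommutativeSemiring.Exp commutativeSemiring using (^-distrib-*)
  open import Algebra.Properties.Ring ring using (+-cancelʳ; -1*x≈-x; -‿involutive)
  import Algebra.Solver.Ring.NaturalCoefficients.Default commutativeSemiring as NS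

  ×-zeroʳ : ∀ m → m ×ᴿ 0# ≈ 0#
  ×-zeroʳ zero    = refl
  ×-zeroʳ (suc m) = trans (+-identityˡ _) (×-zeroʳ m)

  sumRange-cong : ∀ n {f g : ℕ → Carrier} → (∀ i → i < n → f i ≈ g i) → sumRange n f ≈ sumRange n g
  sumRange-cong zero    f≈g = refl
  sumRange-cong (suc n) f≈g = +-cong (sumRange-cong n (λ i i<n → f≈g i (ℕₚ.m<n⇒m<1+n i<n))) (f≈g n (ℕₚ.n<1+n n))

  sumRange-+ : ∀ n (f g : ℕ → Carrier) → sumRange n (λ i → f i +ᴿ g i) ≈ sumRange n f +ᴿ sumRange n g
  sumRange-+ zero    f g = sym (+-identityˡ 0#)
  sumRange-+ (suc n) f g = trans (+-congʳ (sumRange-+ n f g)) (interchange _ _ _ _)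

  ×-sumRange : ∀ m n (f : ℕ → Carrier) → m ×ᴿ sumRange n f ≈ sumRange n (λ i → m ×ᴿ f i)
  ×-sumRange m zero    f = ×-zeroʳ m
  ×-sumRange m (suc n) f = trans (×-distrib-+ _ _ m) (+-congʳ (×-sumRange m n f))

  sumRange-suc : ∀ n (f : ℕ → Carrier) → sumRange (suc n) f ≈ f 0 +ᴿ sumRange n (f ∘ suc)
  sumRange-suc zero    f = trans (+-identityˡ _) (sym (+-identityʳ _))
  sumRange-suc (suc n) f = trans (+-congʳ (sumRange-suc n f)) (+-assoc _ _ _)

  sumTo-pascal : ∀ m (v : ℕ → Carrier) →
    sumTo (suc m) (λ s → (suc m C s) ×ᴿ v s) ≈
      sumTo m (λ s → (m C s) ×ᴿ v s) +ᴿ sumTo m (λ s → (m C s) ×ᴿ v (suc s))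
  sumTo-pascal m v = begin
    sumTo (suc m) (λ s → (suc m C s) ×ᴿ v s)
      ≈⟨ sumRange-suc (suc m) _ ⟩
    1 ×ᴿ v 0 +ᴿ sumRange (suc m) (λ s → (suc m C suc s) ×ᴿ v (suc s))
      ≈⟨ +-congˡ (sumRange-cong (suc m) (λ s _ → pascal-term s)) ⟩
    1 ×ᴿ v 0 +ᴿ sumRange (suc m) (λ s → (m C s) ×ᴿ v (suc s) +ᴿ (m C suc s) ×ᴿ v (suc s))
      ≈⟨ +-congˡ (sumRange-+ (suc m) _ _) ⟩
    1 ×ᴿ v 0 +ᴿ (shifted +ᴿ (inner +ᴿ (m C suc m) ×ᴿ v (suc m)))
      ≈⟨ +-congˡ (+-congˡ (+-congˡ (×-congˡ (k>n⇒nCk≡0 (ℕₚ.n<1+n m))))) ⟩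
    1 ×ᴿ v 0 +ᴿ (shifted +ᴿ (inner +ᴿ 0#))
      ≈⟨ +-congˡ (trans (+-congˡ (+-identityʳ inner)) (+-comm shifted inner)) ⟩
    1 ×ᴿ v 0 +ᴿ (inner +ᴿ shifted)
      ≈⟨ sym (+-assoc _ _ _) ⟩
    (1 ×ᴿ v 0 +ᴿ inner) +ᴿ shifted
      ≈⟨ +-congʳ (sym (sumRange-suc m _)) ⟩
    sumTo m (λ s → (m C s) ×ᴿ v s) +ᴿ shifted ∎
    where
    shifted inner : Carrier
    shifted = sumTo m (λ s → (m C s) ×ᴿ v (suc s))
    inner = sumRange m (λ s → (m C suc s) ×ᴿ v (suc s))
    pascal-term : ∀ s → (suc m C suc s) ×ᴿ v (suc s) ≈ (m C s) ×ᴿ v (suc s) +ᴿ (m C suc s) ×ᴿ v (suc s)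
    pascal-term s = trans (×-congˡ (≡.sym (nCk+nC[k+1]≡[n+1]C[k+1] m s))) (×-homo-+ _ (m C s) (m C suc s))

  binomial-expansion : (U : ℕ → ℕ → Carrier) → (∀ a b → U a b ≈ U (suc a) b +ᴿ U a (suc b)) →
    ∀ k a b → U a b ≈ sumTo k (λ j → (k C j) ×ᴿ U (a ℕ.+ (k ∸ j)) (b ℕ.+ j))
  binomial-expansion U step zero a b = begin
    U a b                        ≈⟨ reflexive (≡.cong₂ U (≡.sym (ℕₚ.+-identityʳ a)) (≡.sym (ℕₚ.+-identityʳ b))) ⟩
    U (a ℕ.+ 0) (b ℕ.+ 0)        ≈⟨ sym (trans (+-identityˡ _) (×-homo-1 _)) ⟩
    sumTo 0 (λ j → (0 C j) ×ᴿ U (a ℕ.+ (0 ∸ j)) (b ℕ.+ j)) ∎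
  binomial-expansion U step (suc k) a b = begin
    U a b
      ≈⟨ step a b ⟩
    U (suc a) b +ᴿ U a (suc b)
      ≈⟨ +-cong (binomial-expansion U step k (suc a) b) (binomial-expansion U step k a (suc b)) ⟩
    sumTo k (λ j → (k C j) ×ᴿ U (suc a ℕ.+ (k ∸ j)) (b ℕ.+ j)) +ᴿ
      sumTo k (λ j → (k C j) ×ᴿ U (a ℕ.+ (k ∸ j)) (suc b ℕ.+ j))
      ≈⟨ +-cong (sumRange-cong (suc k) (λ j j≤k → ×-congʳ (k C j) (reflexive (≡.cong (λ x → U x (b ℕ.+ j)) (first-index j (ℕₚ.≤-pred j≤k))))))
                (sumRange-cong (suc k) (λ j _ → ×-congʳ (k C j) (reflexive (≡.cong (U (a ℕ.+ (k ∸ j))) (≡.sym (ℕₚ.+-suc b j)))))) ⟩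
    sumTo k (λ j → (k C j) ×ᴿ v j) +ᴿ sumTo k (λ j → (k C j) ×ᴿ v (suc j))
      ≈⟨ sym (sumTo-pascal k v) ⟩
    sumTo (suc k) (λ j → (suc k C j) ×ᴿ v j) ∎
    where
    v : ℕ → Carrier
    v j = U (a ℕ.+ (suc k ∸ j)) (b ℕ.+ j)
    first-index : ∀ j → j ≤ k → suc a ℕ.+ (k ∸ j) ≡ a ℕ.+ (suc k ∸ j)
    first-index j j≤k = ≡.trans (≡.sym (ℕₚ.+-suc a (k ∸ j))) (≡.cong (a ℕ.+_) (≡.sym (ℕₚ.+-∸-assoc 1 j≤k)))

  trinomial-expansion : (u : ℕ → ℕ → ℕ → Carrier) →
    (∀ a b s → u a b s ≈ (u (suc a) b s +ᴿ u a (suc b) s) +ᴿ u a b (suc s)) →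
    ∀ k → u 0 0 0 ≈ sumTo k (λ j → sumTo j (λ s → (k C j) ×ᴿ ((j C s) ×ᴿ u (k ∸ j) (j ∸ s) s)))
  trinomial-expansion u step k = begin
    u 0 0 0                                  ≈⟨ sym (trans (+-identityˡ _) (×-homo-1 _)) ⟩
    U 0 0                                    ≈⟨ binomial-expansion U U-step k 0 0 ⟩
    sumTo k (λ j → (k C j) ×ᴿ U (k ∸ j) j)    ≈⟨ sumRange-cong (suc k) (λ j _ → ×-sumRange (k C j) (suc j) _) ⟩
    sumTo k (λ j → sumTo j (λ s → (k C j) ×ᴿ ((j C s) ×ᴿ u (k ∸ j) (j ∸ s) s))) ∎
    where
    U : ℕ → ℕ → Carrier
    U a m = sumTo m (λ s → (m C s) ×ᴿ u a (m ∸ s) s)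

    U-step : ∀ a m → U a m ≈ U (suc a) m +ᴿ U a (suc m)
    U-step a m = begin
      U a m
        ≈⟨ sumRange-cong (suc m) (λ s _ → trans (×-congʳ (m C s) (step a (m ∸ s) s))
                                       (trans (×-distrib-+ _ _ (m C s)) (+-congʳ (×-distrib-+ _ _ (m C s))))) ⟩
      sumTo m (λ s → ((m C s) ×ᴿ u (suc a) (m ∸ s) s +ᴿ (m C s) ×ᴿ u a (suc (m ∸ s)) s)
                      +ᴿ (m C s) ×ᴿ u a (m ∸ s) (suc s))
        ≈⟨ trans (sumRange-+ (suc m) _ _) (+-congʳ (sumRange-+ (suc m) _ _)) ⟩
      (U (suc a) m +ᴿ sumTo m (λ s → (m C s) ×ᴿ u a (suc (m ∸ s)) s)) +ᴿ sumTo m (λ s → (m C s) ×ᴿ v (suc s))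
        ≈⟨ +-assoc _ _ _ ⟩
      U (suc a) m +ᴿ (sumTo m (λ s → (m C s) ×ᴿ u a (suc (m ∸ s)) s) +ᴿ sumTo m (λ s → (m C s) ×ᴿ v (suc s)))
        ≈⟨ +-congˡ (+-congʳ (sumRange-cong (suc m) (λ s s≤m → ×-congʳ (m C s)
              (reflexive (≡.cong (λ x → u a x s) (≡.sym (ℕₚ.+-∸-assoc 1 (ℕₚ.≤-pred s≤m)))))))) ⟩
      U (suc a) m +ᴿ (sumTo m (λ s → (m C s) ×ᴿ v s) +ᴿ sumTo m (λ s → (m C s) ×ᴿ v (suc s)))
        ≈⟨ +-congˡ (sym (sumTo-pascal m v)) ⟩
      U (suc a) m +ᴿ U a (suc m) ∎
      where
      v : ℕ → Carrier
      v s = u a (suc m ∸ s) s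

  at-differences : ∀ {p} (F : ℕ → ℕ → ℕ → ℕ → ℕ → Set p) → (∀ a b s → F (s ℕ.+ b ℕ.+ a) (s ℕ.+ b) s a b) →
                   ∀ k j s → s ≤ j → j ≤ k → F k j s (k ∸ j) (j ∸ s)
  at-differences F h k j s s≤j j≤k =
    ≡.subst (λ K → F K j s (k ∸ j) (j ∸ s)) (ℕₚ.m+[n∸m]≡n j≤k)
      (≡.subst (λ J → F (J ℕ.+ (k ∸ j)) J s (k ∸ j) (j ∸ s)) (ℕₚ.m+[n∸m]≡n s≤j) (h (k ∸ j) (j ∸ s) s))

  module ThreeTermRecurrence (W : ℤ → Carrier) (α β γ : Carrier) (P Q S : ℤ)
    (recurrence : ∀ t → W t ≈ (α *ᴿ W (t + P) +ᴿ β *ᴿ W (t + Q)) +ᴿ γ *ᴿ W (t + S)) where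

    W-cong : ∀ {x y} → x ≡ y → W x ≈ W y
    W-cong x≡y = reflexive (≡.cong W x≡y)

    term : ℤ → ℕ → ℕ → ℕ → Carrier
    term r a b s = ((α ^ a *ᴿ β ^ b) *ᴿ γ ^ s) *ᴿ W (r + ((+ a * P + + b * Q) + + s * S))

    term-step : ∀ r a b s → term r a b s ≈ (term r (suc a) b s +ᴿ term r a (suc b) s) +ᴿ term r a b (suc s)
    term-step r a b s = begin
      coeff *ᴿ W t
        ≈⟨ *-congˡ (recurrence t) ⟩
      coeff *ᴿ ((α *ᴿ W (t + P) +ᴿ β *ᴿ W (t + Q)) +ᴿ γ *ᴿ W (t + S))
        ≈⟨ *-congˡ (+-cong (+-cong (*-congˡ (W-cong (shift-P r (+ a) (+ b) (+ s) P Q S)))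
                                    (*-congˡ (W-cong (shift-Q r (+ a) (+ b) (+ s) P Q S))))
                            (*-congˡ (W-cong (shift-S r (+ a) (+ b) (+ s) P Q S)))) ⟩
      coeff *ᴿ ((α *ᴿ W (idx (suc a) b s) +ᴿ β *ᴿ W (idx a (suc b) s)) +ᴿ γ *ᴿ W (idx a b (suc s)))
        ≈⟨ NS.solve 9 (λ α β γ A B G X Y Z →
             ((A NS.:* B) NS.:* G) NS.:* ((α NS.:* X NS.:+ β NS.:* Y) NS.:+ γ NS.:* Z) NS.:=
             (((α NS.:* A) NS.:* B) NS.:* G) NS.:* X NS.:+ ((A NS.:* (β NS.:* B)) NS.:* G) NS.:* Y
               NS.:+ ((A NS.:* B) NS.:* (γ NS.:* G)) NS.:* Z)
             refl α β γ (α ^ a) (β ^ b) (γ ^ s) (W (idx (suc a) b s)) (W (idx a (suc b) s)) (W (idx a b (suc s))) ⟩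
      (term r (suc a) b s +ᴿ term r a (suc b) s) +ᴿ term r a b (suc s) ∎
      where
      coeff : Carrier
      coeff = (α ^ a *ᴿ β ^ b) *ᴿ γ ^ s
      idx : ℕ → ℕ → ℕ → ℤ
      idx a b s = r + ((+ a * P + + b * Q) + + s * S)
      t : ℤ
      t = idx a b s
      shift-P : ∀ r A B C P Q S → r + ((A * P + B * Q) + C * S) + P ≡ r + (((+ 1 + A) * P + B * Q) + C * S)
      shift-P = solve-∀
      shift-Q : ∀ r A B C P Q S → r + ((A * P + B * Q) + C * S) + Q ≡ r + ((A * P + (+ 1 + B) * Q) + C * S)
      shift-Q = solve-∀
      shift-S : ∀ r A B C P Q S → r + ((A * P + B * Q) + C * S) + S ≡ r + ((A * P + B * Q) + (+ 1 + C) * S)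
      shift-S = solve-∀

    -- The hypotheses are stated at k = s + b + a, j = s + b, where no truncated subtraction occurs.
    expansion : ∀ r (c p : ℕ → ℕ → ℕ → Carrier) (ix : ℕ → ℕ → ℕ → ℤ) →
      (∀ a b s → c (s ℕ.+ b ℕ.+ a) (s ℕ.+ b) s *ᴿ p (s ℕ.+ b ℕ.+ a) (s ℕ.+ b) s ≈ (α ^ a *ᴿ β ^ b) *ᴿ γ ^ s) →
      (∀ a b s → ix (s ℕ.+ b ℕ.+ a) (s ℕ.+ b) s ≡ r + ((+ a * P + + b * Q) + + s * S)) →
      ∀ k → sumTo k (λ j → sumTo j (λ s → c k j s *ᴿ binom k j (binom j s (p k j s *ᴿ W (ix k j s))))) ≈ W r
    expansion r c p ix coeff-eq index-eq k = begin
      sumTo k (λ j → sumTo j (λ s → c k j s *ᴿ binom k j (binom j s (p k j s *ᴿ W (ix k j s)))))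
        ≈⟨ sumRange-cong (suc k) (λ j j≤k → sumRange-cong (suc j) (λ s s≤j →
             summand j s (ℕₚ.≤-pred s≤j) (ℕₚ.≤-pred j≤k))) ⟩
      sumTo k (λ j → sumTo j (λ s → (k C j) ×ᴿ ((j C s) ×ᴿ term r (k ∸ j) (j ∸ s) s)))
        ≈⟨ sym (trinomial-expansion (term r) (term-step r) k) ⟩
      ((1# *ᴿ 1#) *ᴿ 1#) *ᴿ W (r + + 0)
        ≈⟨ *-cong (trans (*-identityʳ _) (*-identityʳ 1#)) (reflexive (≡.cong W (ℤₚ.+-identityʳ r))) ⟩
      1# *ᴿ W r
        ≈⟨ *-identityˡ (W r) ⟩
      W r ∎
      where
      summand : ∀ j s → s ≤ j → j ≤ k →
        c k j s *ᴿ binom k j (binom j s (p k j s *ᴿ W (ix k j s))) ≈ (k C j) ×ᴿ ((j C s) ×ᴿ term r (k ∸ j) (j ∸ s) s)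
      summand j s s≤j j≤k = begin
        c k j s *ᴿ ((k C j) ×ᴿ ((j C s) ×ᴿ (p k j s *ᴿ W (ix k j s))))
          ≈⟨ trans (×-comm-* (k C j) _ _) (×-congʳ (k C j) (×-comm-* (j C s) _ _)) ⟩
        (k C j) ×ᴿ ((j C s) ×ᴿ (c k j s *ᴿ (p k j s *ᴿ W (ix k j s))))
          ≈⟨ ×-congʳ (k C j) (×-congʳ (j C s) (trans (sym (*-assoc _ _ _)) (*-cong coeff-at (W-cong index-at)))) ⟩
        (k C j) ×ᴿ ((j C s) ×ᴿ term r (k ∸ j) (j ∸ s) s) ∎
        where
        coeff-at : c k j s *ᴿ p k j s ≈ (α ^ (k ∸ j) *ᴿ β ^ (j ∸ s)) *ᴿ γ ^ s
        coeff-at = at-differences (λ K J s a b → c K J s *ᴿ p K J s ≈ (α ^ a *ᴿ β ^ b) *ᴿ γ ^ s) coeff-eq k j s s≤j j≤k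
        index-at : ix k j s ≡ r + ((+ (k ∸ j) * P + + (j ∸ s) * Q) + + s * S)
        index-at = at-differences (λ K J s a b → ix K J s ≡ r + ((+ a * P + + b * Q) + + s * S)) index-eq k j s s≤j j≤k

  1^n≈1 : ∀ n → 1# ^ n ≈ 1#
  1^n≈1 zero    = refl
  1^n≈1 (suc n) = trans (*-identityˡ _) (1^n≈1 n)

  x*1^n≈x : ∀ x n → x *ᴿ 1# ^ n ≈ x
  x*1^n≈x x n = trans (*-congˡ (1^n≈1 n)) (*-identityʳ x)

  1^n*x≈x : ∀ n x → 1# ^ n *ᴿ x ≈ x
  1^n*x≈x n x = trans (*-congʳ (1^n≈1 n)) (*-identityˡ x)

  -1^[n+n]≈1 : ∀ n → (-ᴿ 1#) ^ (n ℕ.+ n) ≈ 1#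
  -1^[n+n]≈1 zero    = refl
  -1^[n+n]≈1 (suc n) = begin
    (-ᴿ 1#) *ᴿ (-ᴿ 1#) ^ (n ℕ.+ suc n)         ≈⟨ *-congˡ (^-congʳ (-ᴿ 1#) (ℕₚ.+-suc n n)) ⟩
    (-ᴿ 1#) *ᴿ ((-ᴿ 1#) *ᴿ (-ᴿ 1#) ^ (n ℕ.+ n)) ≈⟨ sym (*-assoc _ _ _) ⟩
    ((-ᴿ 1#) *ᴿ (-ᴿ 1#)) *ᴿ (-ᴿ 1#) ^ (n ℕ.+ n) ≈⟨ *-cong (trans (-1*x≈-x (-ᴿ 1#)) (-‿involutive 1#)) (-1^[n+n]≈1 n) ⟩
    1# *ᴿ 1#                                  ≈⟨ *-identityˡ 1# ⟩
    1# ∎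

  [-x]^n≈[-1]^n*x^n : ∀ x n → (-ᴿ x) ^ n ≈ (-ᴿ 1#) ^ n *ᴿ x ^ n
  [-x]^n≈[-1]^n*x^n x n = trans (^-congˡ n (sym (-1*x≈-x x))) (^-distrib-* (-ᴿ 1#) x n)

  zpow-neg : ∀ x y n → zpow x y (- + n) ≈ y ^ n
  zpow-neg x y zero    = refl
  zpow-neg x y (suc n) = refl

  [-1]^[s+b+s]≈[-1]^b : ∀ s b → (-ᴿ 1#) ^ (s ℕ.+ b ℕ.+ s) ≈ (-ᴿ 1#) ^ b
  [-1]^[s+b+s]≈[-1]^b s b = begin
    (-ᴿ 1#) ^ (s ℕ.+ b ℕ.+ s)               ≈⟨ ^-congʳ (-ᴿ 1#) (reorder s b) ⟩
    (-ᴿ 1#) ^ (b ℕ.+ (s ℕ.+ s))             ≈⟨ ^-homo-* (-ᴿ 1#) b (s ℕ.+ s) ⟩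
    (-ᴿ 1#) ^ b *ᴿ (-ᴿ 1#) ^ (s ℕ.+ s)       ≈⟨ trans (*-congˡ (-1^[n+n]≈1 s)) (*-identityʳ _) ⟩
    (-ᴿ 1#) ^ b ∎
    where
    reorder : ∀ s b → s ℕ.+ b ℕ.+ s ≡ b ℕ.+ (s ℕ.+ s)
    reorder s b = ≡.trans (≡.cong (ℕ._+ s) (ℕₚ.+-comm s b)) (ℕₚ.+-assoc b s s)

  [-1]^s*x^[a+s]≈x^a*1^b*[-x]^s : ∀ x a b s → (-ᴿ 1#) ^ s *ᴿ x ^ (a ℕ.+ s) ≈ (x ^ a *ᴿ 1# ^ b) *ᴿ (-ᴿ x) ^ s
  [-1]^s*x^[a+s]≈x^a*1^b*[-x]^s x a b s = begin
    (-ᴿ 1#) ^ s *ᴿ x ^ (a ℕ.+ s)       ≈⟨ *-congˡ (^-homo-* x a s) ⟩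
    (-ᴿ 1#) ^ s *ᴿ (x ^ a *ᴿ x ^ s)     ≈⟨ x*yz≈y*xz _ _ _ ⟩
    x ^ a *ᴿ ((-ᴿ 1#) ^ s *ᴿ x ^ s)     ≈⟨ *-cong (sym (x*1^n≈x _ b)) (sym ([-x]^n≈[-1]^n*x^n x s)) ⟩
    (x ^ a *ᴿ 1# ^ b) *ᴿ (-ᴿ x) ^ s ∎

  four*x≈x+x+x+x : ∀ x → four *ᴿ x ≈ x +ᴿ (x +ᴿ (x +ᴿ x))
  four*x≈x+x+x+x x = trans (×-assoc-* 4 1# x) (trans (×-congʳ 4 (*-identityˡ x))
    (+-congˡ (+-congˡ (+-congˡ (+-identityʳ x)))))

  x+wz≈y⇒x≈y+[-w]z : ∀ {x y z} w → x +ᴿ w *ᴿ z ≈ y → x ≈ y +ᴿ (-ᴿ w) *ᴿ z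
  x+wz≈y⇒x≈y+[-w]z {x} {y} {z} w x+wz≈y = +-cancelʳ (w *ᴿ z) x (y +ᴿ (-ᴿ w) *ᴿ z) (begin
    x +ᴿ w *ᴿ z                       ≈⟨ x+wz≈y ⟩
    y                                 ≈⟨ sym (+-identityʳ y) ⟩
    y +ᴿ 0#                           ≈⟨ +-congˡ (sym (trans (sym (distribʳ z (-ᴿ w) w)) (trans (*-congʳ (-‿inverseˡ w)) (zeroˡ z)))) ⟩
    y +ᴿ ((-ᴿ w) *ᴿ z +ᴿ w *ᴿ z)        ≈⟨ sym (+-assoc _ _ _) ⟩
    (y +ᴿ (-ᴿ w) *ᴿ z) +ᴿ w *ᴿ z ∎)

  module FourTermRelation {x₀ x₁ x₂ x₃ : Carrier} (relation : x₀ +ᴿ four *ᴿ x₁ ≈ four *ᴿ x₂ +ᴿ x₃) where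

    solve-x₀ : x₀ ≈ (four *ᴿ x₂ +ᴿ (-ᴿ four) *ᴿ x₁) +ᴿ 1# *ᴿ x₃
    solve-x₀ = begin
      x₀                                        ≈⟨ x+wz≈y⇒x≈y+[-w]z four relation ⟩
      (four *ᴿ x₂ +ᴿ x₃) +ᴿ (-ᴿ four) *ᴿ x₁       ≈⟨ xy∙z≈xz∙y _ _ _ ⟩
      (four *ᴿ x₂ +ᴿ (-ᴿ four) *ᴿ x₁) +ᴿ x₃       ≈⟨ +-congˡ (sym (*-identityˡ x₃)) ⟩
      (four *ᴿ x₂ +ᴿ (-ᴿ four) *ᴿ x₁) +ᴿ 1# *ᴿ x₃ ∎

    solve-x₃ : x₃ ≈ (1# *ᴿ x₀ +ᴿ (-ᴿ four) *ᴿ x₂) +ᴿ four *ᴿ x₁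
    solve-x₃ = begin
      x₃                                        ≈⟨ x+wz≈y⇒x≈y+[-w]z four (trans (+-comm _ _) (sym relation)) ⟩
      (x₀ +ᴿ four *ᴿ x₁) +ᴿ (-ᴿ four) *ᴿ x₂       ≈⟨ xy∙z≈xz∙y _ _ _ ⟩
      (x₀ +ᴿ (-ᴿ four) *ᴿ x₂) +ᴿ four *ᴿ x₁       ≈⟨ +-congʳ (+-congʳ (sym (*-identityˡ x₀))) ⟩
      (1# *ᴿ x₀ +ᴿ (-ᴿ four) *ᴿ x₂) +ᴿ four *ᴿ x₁ ∎

    module _ (inv4 : Carrier) (four*inv4≈1 : four *ᴿ inv4 ≈ 1#) where

      relation/4 : inv4 *ᴿ x₀ +ᴿ x₁ ≈ x₂ +ᴿ inv4 *ᴿ x₃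
      relation/4 = begin
        inv4 *ᴿ x₀ +ᴿ x₁                    ≈⟨ +-congˡ (sym (inv4*[four*x]≈x x₁)) ⟩
        inv4 *ᴿ x₀ +ᴿ inv4 *ᴿ (four *ᴿ x₁)   ≈⟨ sym (distribˡ inv4 _ _) ⟩
        inv4 *ᴿ (x₀ +ᴿ four *ᴿ x₁)           ≈⟨ *-congˡ relation ⟩
        inv4 *ᴿ (four *ᴿ x₂ +ᴿ x₃)           ≈⟨ distribˡ inv4 _ _ ⟩
        inv4 *ᴿ (four *ᴿ x₂) +ᴿ inv4 *ᴿ x₃   ≈⟨ +-congʳ (inv4*[four*x]≈x x₂) ⟩
        x₂ +ᴿ inv4 *ᴿ x₃ ∎
        where
        inv4*[four*x]≈x : ∀ x → inv4 *ᴿ (four *ᴿ x) ≈ x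
        inv4*[four*x]≈x x = trans (sym (*-assoc _ _ _)) (trans (*-congʳ (trans (*-comm inv4 four) four*inv4≈1)) (*-identityˡ x))

      solve-x₁ : x₁ ≈ ((-ᴿ inv4) *ᴿ x₀ +ᴿ 1# *ᴿ x₂) +ᴿ inv4 *ᴿ x₃
      solve-x₁ = begin
        x₁                                         ≈⟨ x+wz≈y⇒x≈y+[-w]z inv4 (trans (+-comm _ _) relation/4) ⟩
        (x₂ +ᴿ inv4 *ᴿ x₃) +ᴿ (-ᴿ inv4) *ᴿ x₀        ≈⟨ xy∙z≈zx∙y _ _ _ ⟩
        ((-ᴿ inv4) *ᴿ x₀ +ᴿ x₂) +ᴿ inv4 *ᴿ x₃        ≈⟨ +-congʳ (+-congˡ (sym (*-identityˡ x₂))) ⟩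
        ((-ᴿ inv4) *ᴿ x₀ +ᴿ 1# *ᴿ x₂) +ᴿ inv4 *ᴿ x₃ ∎

      solve-x₂ : x₂ ≈ (inv4 *ᴿ x₀ +ᴿ 1# *ᴿ x₁) +ᴿ (-ᴿ inv4) *ᴿ x₃
      solve-x₂ = begin
        x₂                                         ≈⟨ x+wz≈y⇒x≈y+[-w]z inv4 (sym relation/4) ⟩
        (inv4 *ᴿ x₀ +ᴿ x₁) +ᴿ (-ᴿ inv4) *ᴿ x₃        ≈⟨ +-congʳ (+-congˡ (sym (*-identityˡ x₁))) ⟩
        (inv4 *ᴿ x₀ +ᴿ 1# *ᴿ x₁) +ᴿ (-ᴿ inv4) *ᴿ x₃ ∎

  module GeneralizedFibonacci (m : ℕ) (W : ℤ → Carrier) (fib : IsGenFib (suc m) W) where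

    N D : ℤ
    N = + suc m
    D = + 2 * N

    W-cong : ∀ {x y} → x ≡ y → W x ≈ W y
    W-cong x≡y = reflexive (≡.cong W x≡y)

    two-step : ∀ t → W (t + + 1) +ᴿ W (t - N) ≈ W t +ᴿ W t
    two-step t = begin
      W (t + + 1) +ᴿ W (t - N)
        ≈⟨ +-congʳ (trans (fib (t + + 1)) (sumRange-suc m _)) ⟩
      (W (t + + 1 - + 1) +ᴿ sumRange m (λ i → W (t + + 1 - (+ 1 + + suc i)))) +ᴿ W (t - N)
        ≈⟨ +-congʳ (+-cong (W-cong (t+1-1≡t t)) (sumRange-cong m (λ i _ → W-cong (t+1-[1+I]≡t-I t (+ suc i))))) ⟩
      (W t +ᴿ sumRange m (λ i → W (t - + suc i))) +ᴿ W (t - N)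
        ≈⟨ +-assoc _ _ _ ⟩
      W t +ᴿ sumRange (suc m) (λ i → W (t - + suc i))
        ≈⟨ +-congˡ (sym (fib t)) ⟩
      W t +ᴿ W t ∎
      where
      t+1-1≡t : ∀ t → t + + 1 - + 1 ≡ t
      t+1-1≡t = solve-∀
      t+1-[1+I]≡t-I : ∀ t I → t + + 1 - (+ 1 + I) ≡ t - I
      t+1-[1+I]≡t-I = solve-∀

    -- After adding B + 2A to both sides, the instances at-A, at-X, at-Y of two-step turn one side into the other.
    four-term : ∀ t → W t +ᴿ four *ᴿ W (t + (D + + 1)) ≈ four *ᴿ W (t + D) +ᴿ W (t + (D + + 2))
    four-term t = +-cancelʳ (B +ᴿ (A +ᴿ A)) _ _ (begin
      (W t +ᴿ four *ᴿ Y) +ᴿ (B +ᴿ (A +ᴿ A))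
        ≈⟨ +-congʳ (+-congˡ (four*x≈x+x+x+x Y)) ⟩
      (W t +ᴿ (Y +ᴿ (Y +ᴿ (Y +ᴿ Y)))) +ᴿ (B +ᴿ (A +ᴿ A))
        ≈⟨ NS.solve 4 (λ w y a b →
             (w NS.:+ (y NS.:+ (y NS.:+ (y NS.:+ y)))) NS.:+ (b NS.:+ (a NS.:+ a)) NS.:=
             ((b NS.:+ w) NS.:+ ((y NS.:+ a) NS.:+ (y NS.:+ a))) NS.:+ (y NS.:+ y)) refl (W t) Y A B ⟩
      ((B +ᴿ W t) +ᴿ ((Y +ᴿ A) +ᴿ (Y +ᴿ A))) +ᴿ (Y +ᴿ Y)
        ≈⟨ +-cong (+-cong at-A (+-cong at-X at-X)) (sym at-Y) ⟩
      ((A +ᴿ A) +ᴿ ((X +ᴿ X) +ᴿ (X +ᴿ X))) +ᴿ (Z +ᴿ B)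
        ≈⟨ NS.solve 4 (λ x z a b →
             ((a NS.:+ a) NS.:+ ((x NS.:+ x) NS.:+ (x NS.:+ x))) NS.:+ (z NS.:+ b) NS.:=
             ((x NS.:+ (x NS.:+ (x NS.:+ x))) NS.:+ z) NS.:+ (b NS.:+ (a NS.:+ a))) refl X Z A B ⟩
      ((X +ᴿ (X +ᴿ (X +ᴿ X))) +ᴿ Z) +ᴿ (B +ᴿ (A +ᴿ A))
        ≈⟨ +-congʳ (+-congʳ (sym (four*x≈x+x+x+x X))) ⟩
      (four *ᴿ X +ᴿ Z) +ᴿ (B +ᴿ (A +ᴿ A)) ∎)
      where
      A B X Y Z : Carrier
      A = W (t + N)
      B = W (t + N + + 1)
      X = W (t + D)
      Y = W (t + (D + + 1))
      Z = W (t + (D + + 2))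
      two-step-from : ∀ u {v w} → u + + 1 ≡ v → u - N ≡ w → W v +ᴿ W w ≈ W u +ᴿ W u
      two-step-from u ≡.refl ≡.refl = two-step u
      t+N-N≡t : ∀ t N → t + N - N ≡ t
      t+N-N≡t = solve-∀
      t+2N-N≡t+N : ∀ t N → t + + 2 * N - N ≡ t + N
      t+2N-N≡t+N = solve-∀
      t+[2N+1]+1≡t+[2N+2] : ∀ t N → t + (+ 2 * N + + 1) + + 1 ≡ t + (+ 2 * N + + 2)
      t+[2N+1]+1≡t+[2N+2] = solve-∀
      t+[2N+1]-N≡t+N+1 : ∀ t N → t + (+ 2 * N + + 1) - N ≡ t + N + + 1
      t+[2N+1]-N≡t+N+1 = solve-∀
      at-A : B +ᴿ W t ≈ A +ᴿ A
      at-A = two-step-from (t + N) ≡.refl (t+N-N≡t t N)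
      at-X : Y +ᴿ A ≈ X +ᴿ X
      at-X = two-step-from (t + D) (ℤₚ.+-assoc t D (+ 1)) (t+2N-N≡t+N t N)
      at-Y : Z +ᴿ B ≈ Y +ᴿ Y
      at-Y = two-step-from (t + (D + + 1)) (t+[2N+1]+1≡t+[2N+2] t N) (t+[2N+1]-N≡t+N+1 t N)

    four-term-from : ∀ u t →
      W (t + u) +ᴿ four *ᴿ W (t + (u + (D + + 1))) ≈ four *ᴿ W (t + (u + D)) +ᴿ W (t + (u + (D + + 2)))
    four-term-from u t = begin
      W (t + u) +ᴿ four *ᴿ W (t + (u + (D + + 1)))
        ≈⟨ +-congˡ (*-congˡ (W-cong (≡.sym (ℤₚ.+-assoc t u _)))) ⟩
      W (t + u) +ᴿ four *ᴿ W (t + u + (D + + 1))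
        ≈⟨ four-term (t + u) ⟩
      four *ᴿ W (t + u + D) +ᴿ W (t + u + (D + + 2))
        ≈⟨ +-cong (*-congˡ (W-cong (ℤₚ.+-assoc t u _))) (W-cong (ℤₚ.+-assoc t u _)) ⟩
      four *ᴿ W (t + (u + D)) +ᴿ W (t + (u + (D + + 2))) ∎

    t+[-x+x]≡t : ∀ t x → t + (- x + x) ≡ t
    t+[-x+x]≡t = solve-∀

    P₁ : ℤ
    P₁ = - (D + + 2)

    recurrence₁ : ∀ t → W t ≈ (1# *ᴿ W (t + P₁) +ᴿ (-ᴿ four) *ᴿ W (t + (P₁ + D))) +ᴿ four *ᴿ W (t + (P₁ + (D + + 1)))
    recurrence₁ t = FourTermRelation.solve-x₃
      (trans (four-term-from P₁ t) (+-congˡ (W-cong (t+[-x+x]≡t t (D + + 2)))))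

    recurrence₂ : ∀ t → W t ≈ ((-ᴿ four) *ᴿ W (t + (P₁ + D)) +ᴿ 1# *ᴿ W (t + P₁)) +ᴿ four *ᴿ W (t + (P₁ + (D + + 1)))
    recurrence₂ t = trans (recurrence₁ t) (xy∙z≈yx∙z _ _ _)

    recurrence₃ : ∀ t → W t ≈ (four *ᴿ W (t + (P₁ + (D + + 1))) +ᴿ 1# *ᴿ W (t + P₁)) +ᴿ (-ᴿ four) *ᴿ W (t + (P₁ + D))
    recurrence₃ t = trans (recurrence₁ t) (xy∙z≈zx∙y _ _ _)

    recurrence₆ : ∀ t → W t ≈ (four *ᴿ W (t + D) +ᴿ (-ᴿ four) *ᴿ W (t + (D + + 1))) +ᴿ 1# *ᴿ W (t + (D + + 2))
    recurrence₆ t = FourTermRelation.solve-x₀ (four-term t)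

    P₄ P₅ : ℤ
    P₄ = - (D + + 1)
    P₅ = - D

    module WithInverseOfFour (inv4 : Carrier) (four*inv4≈1 : four *ᴿ inv4 ≈ 1#) where

      recurrence₄ : ∀ t → W t ≈ ((-ᴿ inv4) *ᴿ W (t + P₄) +ᴿ 1# *ᴿ W (t + (P₄ + D))) +ᴿ inv4 *ᴿ W (t + (P₄ + (D + + 2)))
      recurrence₄ t = FourTermRelation.solve-x₁
        (trans (sym (+-congˡ (*-congˡ (W-cong (t+[-x+x]≡t t (D + + 1)))))) (four-term-from P₄ t)) inv4 four*inv4≈1

      recurrence₅ : ∀ t → W t ≈ (inv4 *ᴿ W (t + P₅) +ᴿ 1# *ᴿ W (t + (P₅ + (D + + 1)))) +ᴿ (-ᴿ inv4) *ᴿ W (t + (P₅ + (D + + 2)))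
      recurrence₅ t = FourTermRelation.solve-x₂
        (trans (four-term-from P₅ t) (+-congʳ (*-congˡ (W-cong (t+[-x+x]≡t t D))))) inv4 four*inv4≈1

      identity₁ : ∀ r k → sumTo k (λ j → sumTo j (λ s →
          sgn (+ j + + s) *ᴿ binom k j (binom j s (pow4 inv4 (+ j)
            *ᴿ W (r - (+ 2 * N + + 2) * (+ k) + + 2 * N * + j + + s))))) ≈ W r
      identity₁ r = ThreeTermRecurrence.expansion W 1# (-ᴿ four) four P₁ (P₁ + D) (P₁ + (D + + 1)) recurrence₁ r
        (λ k j s → sgn (+ j + + s)) (λ k j s → pow4 inv4 (+ j))
        (λ k j s → r - (+ 2 * N + + 2) * (+ k) + + 2 * N * + j + + s)
        coefficients (λ a b s → indices r N (+ a) (+ b) (+ s))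
        where
        coefficients : ∀ a b s → (-ᴿ 1#) ^ (s ℕ.+ b ℕ.+ s) *ᴿ four ^ (s ℕ.+ b) ≈ (1# ^ a *ᴿ (-ᴿ four) ^ b) *ᴿ four ^ s
        coefficients a b s = begin
          (-ᴿ 1#) ^ (s ℕ.+ b ℕ.+ s) *ᴿ four ^ (s ℕ.+ b)
            ≈⟨ *-cong ([-1]^[s+b+s]≈[-1]^b s b) (^-homo-* four s b) ⟩
          (-ᴿ 1#) ^ b *ᴿ (four ^ s *ᴿ four ^ b) ≈⟨ x*yz≈xz*y _ _ _ ⟩
          ((-ᴿ 1#) ^ b *ᴿ four ^ b) *ᴿ four ^ s ≈⟨ *-congʳ (trans (sym ([-x]^n≈[-1]^n*x^n four b)) (sym (1^n*x≈x a _))) ⟩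
          (1# ^ a *ᴿ (-ᴿ four) ^ b) *ᴿ four ^ s ∎
        indices : ∀ r N A B S → r - (+ 2 * N + + 2) * (S + B + A) + + 2 * N * (S + B) + S
          ≡ r + ((A * - (+ 2 * N + + 2) + B * (- (+ 2 * N + + 2) + + 2 * N)) + S * (- (+ 2 * N + + 2) + (+ 2 * N + + 1)))
        indices = solve-∀

      identity₂ : ∀ r k → sumTo k (λ j → sumTo j (λ s →
          powNeg4 inv4 ((+ k) - + j) *ᴿ binom k j (binom j s (pow4 inv4 (+ s)
            *ᴿ W (r - + 2 * (+ k) - + 2 * N * + j + (+ 2 * N + + 1) * + s))))) ≈ W r
      identity₂ r = ThreeTermRecurrence.expansion W (-ᴿ four) 1# four (P₁ + D) P₁ (P₁ + (D + + 1)) recurrence₂ r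
        (λ k j s → powNeg4 inv4 ((+ k) - + j)) (λ k j s → pow4 inv4 (+ s))
        (λ k j s → r - + 2 * (+ k) - + 2 * N * + j + (+ 2 * N + + 1) * + s)
        coefficients (λ a b s → indices r N (+ a) (+ b) (+ s))
        where
        coefficients : ∀ a b s → powNeg4 inv4 (+ (s ℕ.+ b ℕ.+ a) - + (s ℕ.+ b)) *ᴿ four ^ s
                                 ≈ ((-ᴿ four) ^ a *ᴿ 1# ^ b) *ᴿ four ^ s
        coefficients a b s = *-congʳ (trans (reflexive (≡.cong (powNeg4 inv4) (exponent (+ a) (+ b) (+ s))))
                                            (sym (x*1^n≈x _ b)))
          where
          exponent : ∀ A B S → S + B + A - (S + B) ≡ A
          exponent = solve-∀
        indices : ∀ r N A B S → r - + 2 * (S + B + A) - + 2 * N * (S + B) + (+ 2 * N + + 1) * S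
          ≡ r + ((A * (- (+ 2 * N + + 2) + + 2 * N) + B * - (+ 2 * N + + 2)) + S * (- (+ 2 * N + + 2) + (+ 2 * N + + 1)))
        indices = solve-∀

      identity₃ : ∀ r k → sumTo k (λ j → sumTo j (λ s →
          sgn (+ s) *ᴿ binom k j (binom j s (pow4 inv4 ((+ k) - + j + + s)
            *ᴿ W (r - (+ k) - (+ 2 * N + + 1) * + j + + 2 * N * + s))))) ≈ W r
      identity₃ r = ThreeTermRecurrence.expansion W four 1# (-ᴿ four) (P₁ + (D + + 1)) P₁ (P₁ + D) recurrence₃ r
        (λ k j s → sgn (+ s)) (λ k j s → pow4 inv4 ((+ k) - + j + + s))
        (λ k j s → r - (+ k) - (+ 2 * N + + 1) * + j + + 2 * N * + s)
        coefficients (λ a b s → indices r N (+ a) (+ b) (+ s))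
        where
        coefficients : ∀ a b s → (-ᴿ 1#) ^ s *ᴿ pow4 inv4 (+ (s ℕ.+ b ℕ.+ a) - + (s ℕ.+ b) + + s)
                                 ≈ (four ^ a *ᴿ 1# ^ b) *ᴿ (-ᴿ four) ^ s
        coefficients a b s = trans (*-congˡ (reflexive (≡.cong (pow4 inv4) (exponent (+ a) (+ b) (+ s)))))
                                   ([-1]^s*x^[a+s]≈x^a*1^b*[-x]^s four a b s)
          where
          exponent : ∀ A B S → S + B + A - (S + B) + S ≡ A + S
          exponent = solve-∀
        indices : ∀ r N A B S → r - (S + B + A) - (+ 2 * N + + 1) * (S + B) + + 2 * N * S
          ≡ r + ((A * (- (+ 2 * N + + 2) + (+ 2 * N + + 1)) + B * - (+ 2 * N + + 2)) + S * (- (+ 2 * N + + 2) + + 2 * N))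
        indices = solve-∀

      identity₄ : ∀ r k → sumTo k (λ j → sumTo j (λ s →
          sgn (+ j - (+ k)) *ᴿ binom k j (binom j s (pow4 inv4 (+ j - (+ k) - + s)
            *ᴿ W (r - (+ 2 * N + + 1) * (+ k) + + 2 * N * + j + + 2 * + s))))) ≈ W r
      identity₄ r = ThreeTermRecurrence.expansion W (-ᴿ inv4) 1# inv4 P₄ (P₄ + D) (P₄ + (D + + 2)) recurrence₄ r
        (λ k j s → sgn (+ j - (+ k))) (λ k j s → pow4 inv4 (+ j - (+ k) - + s))
        (λ k j s → r - (+ 2 * N + + 1) * (+ k) + + 2 * N * + j + + 2 * + s)
        coefficients (λ a b s → indices r N (+ a) (+ b) (+ s))
        where
        coefficients : ∀ a b s → sgn (+ (s ℕ.+ b) - + (s ℕ.+ b ℕ.+ a)) *ᴿ pow4 inv4 (+ (s ℕ.+ b) - + (s ℕ.+ b ℕ.+ a) - + s)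
                                 ≈ ((-ᴿ inv4) ^ a *ᴿ 1# ^ b) *ᴿ inv4 ^ s
        coefficients a b s = begin
          sgn (+ (s ℕ.+ b) - + (s ℕ.+ b ℕ.+ a)) *ᴿ pow4 inv4 (+ (s ℕ.+ b) - + (s ℕ.+ b ℕ.+ a) - + s)
            ≈⟨ *-cong (trans (reflexive (≡.cong sgn (sign-exponent (+ a) (+ b) (+ s)))) (zpow-neg _ _ a))
                      (trans (reflexive (≡.cong (pow4 inv4) (exponent (+ a) (+ b) (+ s)))) (zpow-neg _ _ (a ℕ.+ s))) ⟩
          (-ᴿ 1#) ^ a *ᴿ inv4 ^ (a ℕ.+ s)       ≈⟨ *-congˡ (^-homo-* inv4 a s) ⟩
          (-ᴿ 1#) ^ a *ᴿ (inv4 ^ a *ᴿ inv4 ^ s) ≈⟨ sym (*-assoc _ _ _) ⟩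
          ((-ᴿ 1#) ^ a *ᴿ inv4 ^ a) *ᴿ inv4 ^ s ≈⟨ *-congʳ (trans (sym ([-x]^n≈[-1]^n*x^n inv4 a)) (sym (x*1^n≈x _ b))) ⟩
          ((-ᴿ inv4) ^ a *ᴿ 1# ^ b) *ᴿ inv4 ^ s ∎
          where
          sign-exponent : ∀ A B S → S + B - (S + B + A) ≡ - A
          sign-exponent = solve-∀
          exponent : ∀ A B S → S + B - (S + B + A) - S ≡ - (A + S)
          exponent = solve-∀
        indices : ∀ r N A B S → r - (+ 2 * N + + 1) * (S + B + A) + + 2 * N * (S + B) + + 2 * S
          ≡ r + ((A * - (+ 2 * N + + 1) + B * (- (+ 2 * N + + 1) + + 2 * N)) + S * (- (+ 2 * N + + 1) + (+ 2 * N + + 2)))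
        indices = solve-∀

      identity₅ : ∀ r k → sumTo k (λ j → sumTo j (λ s →
          sgn (+ s) *ᴿ binom k j (binom j s (pow4 inv4 (+ j - (+ k) - + s)
            *ᴿ W (r - + 2 * N * (+ k) + (+ 2 * N + + 1) * + j + + s))))) ≈ W r
      identity₅ r = ThreeTermRecurrence.expansion W inv4 1# (-ᴿ inv4) P₅ (P₅ + (D + + 1)) (P₅ + (D + + 2)) recurrence₅ r
        (λ k j s → sgn (+ s)) (λ k j s → pow4 inv4 (+ j - (+ k) - + s))
        (λ k j s → r - + 2 * N * (+ k) + (+ 2 * N + + 1) * + j + + s)
        coefficients (λ a b s → indices r N (+ a) (+ b) (+ s))
        where
        coefficients : ∀ a b s → (-ᴿ 1#) ^ s *ᴿ pow4 inv4 (+ (s ℕ.+ b) - + (s ℕ.+ b ℕ.+ a) - + s)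
                                 ≈ (inv4 ^ a *ᴿ 1# ^ b) *ᴿ (-ᴿ inv4) ^ s
        coefficients a b s = trans (*-congˡ (trans (reflexive (≡.cong (pow4 inv4) (exponent (+ a) (+ b) (+ s))))
                                                   (zpow-neg _ _ (a ℕ.+ s))))
                                   ([-1]^s*x^[a+s]≈x^a*1^b*[-x]^s inv4 a b s)
          where
          exponent : ∀ A B S → S + B - (S + B + A) - S ≡ - (A + S)
          exponent = solve-∀
        indices : ∀ r N A B S → r - + 2 * N * (S + B + A) + (+ 2 * N + + 1) * (S + B) + S
          ≡ r + ((A * - (+ 2 * N) + B * (- (+ 2 * N) + (+ 2 * N + + 1))) + S * (- (+ 2 * N) + (+ 2 * N + + 2)))
        indices = solve-∀

      identity₆ : ∀ r k → sumTo k (λ j → sumTo j (λ s →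
          sgn (+ j + + s) *ᴿ binom k j (binom j s (pow4 inv4 ((+ k) - + s)
            *ᴿ W (r + + 2 * N * (+ k) + + j + + s))))) ≈ W r
      identity₆ r = ThreeTermRecurrence.expansion W four (-ᴿ four) 1# D (D + + 1) (D + + 2) recurrence₆ r
        (λ k j s → sgn (+ j + + s)) (λ k j s → pow4 inv4 ((+ k) - + s)) (λ k j s → r + + 2 * N * (+ k) + + j + + s)
        coefficients (λ a b s → indices r N (+ a) (+ b) (+ s))
        where
        coefficients : ∀ a b s → (-ᴿ 1#) ^ (s ℕ.+ b ℕ.+ s) *ᴿ pow4 inv4 (+ (s ℕ.+ b ℕ.+ a) - + s)
                                 ≈ (four ^ a *ᴿ (-ᴿ four) ^ b) *ᴿ 1# ^ s
        coefficients a b s = begin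
          (-ᴿ 1#) ^ (s ℕ.+ b ℕ.+ s) *ᴿ pow4 inv4 (+ (s ℕ.+ b ℕ.+ a) - + s)
            ≈⟨ *-cong ([-1]^[s+b+s]≈[-1]^b s b) (reflexive (≡.cong (pow4 inv4) (exponent (+ a) (+ b) (+ s)))) ⟩
          (-ᴿ 1#) ^ b *ᴿ four ^ (b ℕ.+ a)      ≈⟨ *-congˡ (^-homo-* four b a) ⟩
          (-ᴿ 1#) ^ b *ᴿ (four ^ b *ᴿ four ^ a) ≈⟨ sym (*-assoc _ _ _) ⟩
          ((-ᴿ 1#) ^ b *ᴿ four ^ b) *ᴿ four ^ a ≈⟨ *-congʳ (sym ([-x]^n≈[-1]^n*x^n four b)) ⟩
          (-ᴿ four) ^ b *ᴿ four ^ a            ≈⟨ *-comm _ _ ⟩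
          four ^ a *ᴿ (-ᴿ four) ^ b            ≈⟨ sym (x*1^n≈x _ s) ⟩
          (four ^ a *ᴿ (-ᴿ four) ^ b) *ᴿ 1# ^ s ∎
          where
          exponent : ∀ A B S → S + B + A - S ≡ B + A
          exponent = solve-∀
        indices : ∀ r N A B S → r + + 2 * N * (S + B + A) + (S + B) + S
                                ≡ r + ((A * (+ 2 * N) + B * (+ 2 * N + + 1)) + S * (+ 2 * N + + 2))
        indices = solve-∀

theorem11 : ∀ {c ℓ : Level} (R : CommutativeRing c ℓ) →
    let open RingDefs R in
    (inv4 : Carrier) → four *ᴿ inv4 ≈ 1# →
    (n : ℕ) → 2 ≤ n → (W : ℤ → Carrier) → IsGenFib n W →
    (k : ℕ) (r : ℤ) →
    (sumTo k (λ j → sumTo j (λ s →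
        sgn (+ j + + s) *ᴿ binom k j (binom j s (pow4 inv4 (+ j)
          *ᴿ W (r - (+ 2 * (+ n) + + 2) * (+ k) + + 2 * (+ n) * + j + + s)))))
      ≈ W r)
    ×
    (sumTo k (λ j → sumTo j (λ s →
        powNeg4 inv4 ((+ k) - + j) *ᴿ binom k j (binom j s (pow4 inv4 (+ s)
          *ᴿ W (r - + 2 * (+ k) - + 2 * (+ n) * + j + (+ 2 * (+ n) + + 1) * + s)))))
      ≈ W r)
    ×
    (sumTo k (λ j → sumTo j (λ s →
        sgn (+ s) *ᴿ binom k j (binom j s (pow4 inv4 ((+ k) - + j + + s)
          *ᴿ W (r - (+ k) - (+ 2 * (+ n) + + 1) * + j + + 2 * (+ n) * + s)))))
      ≈ W r)
    ×
    (sumTo k (λ j → sumTo j (λ s →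
        sgn (+ j - (+ k)) *ᴿ binom k j (binom j s (pow4 inv4 (+ j - (+ k) - + s)
          *ᴿ W (r - (+ 2 * (+ n) + + 1) * (+ k) + + 2 * (+ n) * + j + + 2 * + s)))))
      ≈ W r)
    ×
    (sumTo k (λ j → sumTo j (λ s →
        sgn (+ s) *ᴿ binom k j (binom j s (pow4 inv4 (+ j - (+ k) - + s)
          *ᴿ W (r - + 2 * (+ n) * (+ k) + (+ 2 * (+ n) + + 1) * + j + + s)))))
      ≈ W r)
    ×
    (sumTo k (λ j → sumTo j (λ s →
        sgn (+ j + + s) *ᴿ binom k j (binom j s (pow4 inv4 ((+ k) - + s)
          *ᴿ W (r + + 2 * (+ n) * (+ k) + + j + + s)))))
      ≈ W r)
theorem11 R inv4 four*inv4≈1 (suc m) (s≤s _) W fib k r =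
  identity₁ r k , identity₂ r k , identity₃ r k , identity₄ r k , identity₅ r k , identity₆ r k
  where open GeneralizedFibonacci.WithInverseOfFour R m W fib inv4 four*inv4≈1
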